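{- Let $C_1, C_2, C_3, C_4$ be $3\times3\times3$ cubes in $[4]^3$. If the set of points of $[4]^3$ lying in $C_i \cap C_j$ for some $i \ne j$ has at most $29$ elements, then this set is either a $3\times3\times3$ cube or a $3\times3\times3$ cube with one point removed.
   Context: $[4] = \{0,1,2,3\}$. A $3\times3\times3$ cube in $[4]^3$ is a set of the form $A \times B \times C$ with $A,B,C \subseteq [4]$ each of size $3$. The set of points lying in at least two of the sets of a family (with distinct indices) is called the two-intersection of the family. -}

module Defs where

open import Data.Bool using (Bool; true; false; _∧_; _∨_; not)
open import Data.Nat using (ℕ)
open import Data.Fin using (Fin)
open import Data.Fin.Subset using (Subset; _∈_; ∣_∣)
open import Data.Fin.Subset.Properties using (_∈?_)
open import Data.Fin.Properties using (_≟_)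
open import Data.Product using (_×_; _,_; Σ; ∃)
open import Data.List using (List; allFin; cartesianProduct; map; filter; length)
open import Relation.Nullary.Decidable using (does)
open import Relation.Binary.PropositionalEquality using (_≡_)

-- [4] = {0,1,2,3}; points of [4]^3
Point : Set
Point = Fin 4 × Fin 4 × Fin 4

PointSet : Set
PointSet = Point → Bool

allPoints : List Point
allPoints = map (λ { (x , (y , z)) → (x , y , z) })
  (cartesianProduct (allFin 4) (cartesianProduct (allFin 4) (allFin 4)))

card : PointSet → ℕ
card S = length (Data.List.filter (λ p → S p Data.Bool.≟ true) allPoints)

box : Subset 4 → Subset 4 → Subset 4 → PointSet
box A B C (x , y , z) = does (x ∈? A) ∧ does (y ∈? B) ∧ does (z ∈? C)

IsCube : PointSet → Set
IsCube S = Σ (Subset 4) λ A → Σ (Subset 4) λ B → Σ (Subset 4) λ C →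
  (∣ A ∣ ≡ 3) × (∣ B ∣ ≡ 3) × (∣ C ∣ ≡ 3) × (∀ p → S p ≡ box A B C p)

record Cube : Set where
  constructor cube
  field
    A B C : Subset 4
    ∣A∣≡3 : ∣ A ∣ ≡ 3
    ∣B∣≡3 : ∣ B ∣ ≡ 3
    ∣C∣≡3 : ∣ C ∣ ≡ 3

⟦_⟧ : Cube → PointSet
⟦ cube A B C _ _ _ ⟧ = box A B C

twoInt4 : PointSet → PointSet → PointSet → PointSet → PointSet
twoInt4 S₁ S₂ S₃ S₄ p =
  (S₁ p ∧ S₂ p) ∨ (S₁ p ∧ S₃ p) ∨ (S₁ p ∧ S₄ p) ∨
  (S₂ p ∧ S₃ p) ∨ (S₂ p ∧ S₄ p) ∨ (S₃ p ∧ S₄ p)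

_≟ₚ_ : (p q : Point) → Bool
(x , y , z) ≟ₚ (x' , y' , z') = does (x ≟ x') ∧ does (y ≟ y') ∧ does (z ≟ z')

IsCubeMinusPoint : PointSet → Set
IsCubeMinusPoint S = Σ PointSet λ K → IsCube K × Σ Point λ q →
  (K q ≡ true) × (∀ p → S p ≡ (K p ∧ not (p ≟ₚ q)))

module Submission where

-- A 3×3×3 cube in [4]³ is the complement of three coordinate hyperplanes, so it is determined by
-- the point m whose coordinates it misses, and four cubes amount to three columns in [4]⁴, one per
-- axis. Permuting the values of each coordinate independently preserves two-intersections and their
-- sizes, and brings every column to one of 15 normal forms. The remaining 15³ configurations are
-- settled by computation: each two-intersection either has more than 29 points or is recognised as
-- a cube, possibly with one point removed.

open import Defs
open import Data.Bool using (Bool; true; false; not; _∧_; T)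
import Data.Bool as Bool
open import Data.Fin using (Fin; zero; suc)
open import Data.Fin.Patterns using (0F; 1F; 2F; 3F)
open import Data.Fin.Permutation
  using (Permutation′; _⟨$⟩ʳ_; _⟨$⟩ˡ_; inverseˡ; inverseʳ; id; flip; _∘ₚ_; transpose; lift₀)
open import Data.Fin.Properties using (_≟_)
import Data.Fin.Properties as Fin
open import Data.Fin.Subset using (Subset; outside; inside; ∁; ⁅_⁆; ∣_∣)
open import Data.Fin.Subset.Properties renaming (_∈?_ to _∈ₛ?_)
  using (x∈∁p⇒x∉p; x∉p⇒x∈∁p; x∈⁅y⁆⇔x≡y; ∣p∣≡n⇒p≡⊤; ∣∁p∣≡n∸∣p∣; ∣⁅x⁆∣≡1)
open import Data.List
  using (List; []; _∷_; _++_; map; filter; length; allFin; cartesianProduct; cartesianProductWith)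
open import Data.List.Properties using (map-++; map-∘; map-cong)
open import Data.List.Relation.Unary.Any using (Any; any?; satisfied)
open import Data.Nat using (ℕ; zero; suc; _+_; _∸_; _≤_; _<?_)
open import Data.Maybe using (Maybe; just; nothing; is-just; _>>=_; to-witness-T)
import Data.Maybe as Maybe
open import Data.List.Relation.Unary.All using (All)
import Data.List.Relation.Unary.All as All
open import Data.Nat.ListAction using (sum)
open import Data.Nat.ListAction.Properties using (sum-++)
open import Data.Nat.Properties using (+-0-commutativeMonoid; suc-injective; <⇒≱)
open import Algebra.Properties.CommutativeMonoid.Sum +-0-commutativeMonoid
  using (sum-permute; sum-cong-≗) renaming (sum to ∑)
open import Data.Product using (_×_; _,_; ∃)
open import Data.Sum using (_⊎_; inj₁; inj₂)
open import Data.Vec using (Vec; _∷_; []; lookup)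
import Data.Vec as Vec
open import Data.Vec.Properties using (map-replicate; lookup-map; ≡-dec)
open import Data.List.Membership.DecPropositional (≡-dec {n = 4} (_≟_ {4})) using (_∈_; _∈?_)
open import Function using (_∘_; const; mk⇔)
open import Relation.Nullary using (Dec; yes; no; does; ¬?; contradiction)
open import Relation.Nullary.Decidable using (does-⇔; from-yes; map′; T?)
open import Relation.Binary.PropositionalEquality
  using (_≡_; _≗_; refl; sym; trans; cong; cong₂; subst; module ≡-Reasoning)

𝟙 : Bool → ℕ
𝟙 true  = 1
𝟙 false = 0

length-filter≡sum-map-𝟙 : ∀ {A : Set} (f : A → Bool) xs →
  length (filter (λ x → f x Bool.≟ true) xs) ≡ sum (map (𝟙 ∘ f) xs)
length-filter≡sum-map-𝟙 f [] = refl
length-filter≡sum-map-𝟙 f (x ∷ xs) with f x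
... | true  = cong suc (length-filter≡sum-map-𝟙 f xs)
... | false = length-filter≡sum-map-𝟙 f xs

sum-map-cartesianProduct : ∀ {A B : Set} (f : A × B → ℕ) xs ys →
  sum (map f (cartesianProduct xs ys)) ≡ sum (map (λ x → sum (map (λ y → f (x , y)) ys)) xs)
sum-map-cartesianProduct f [] ys = refl
sum-map-cartesianProduct f (x ∷ xs) ys = begin
  sum (map f (map (x ,_) ys ++ cartesianProduct xs ys))
    ≡⟨ cong sum (map-++ f (map (x ,_) ys) _) ⟩
  sum (map f (map (x ,_) ys) ++ map f (cartesianProduct xs ys))
    ≡⟨ sum-++ (map f (map (x ,_) ys)) _ ⟩
  sum (map f (map (x ,_) ys)) + sum (map f (cartesianProduct xs ys))
    ≡⟨ cong₂ _+_ (cong sum (sym (map-∘ ys))) (sum-map-cartesianProduct f xs ys) ⟩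
  sum (map (λ y → f (x , y)) ys) + sum (map (λ x → sum (map (λ y → f (x , y)) ys)) xs) ∎
  where open ≡-Reasoning

card-∑ : ∀ S → card S ≡ ∑ λ x → ∑ λ y → ∑ λ z → 𝟙 (S (x , y , z))
card-∑ S = begin
  card S
    ≡⟨ length-filter≡sum-map-𝟙 S allPoints ⟩
  sum (map (𝟙 ∘ S) allPoints)
    ≡⟨ sum-map-cartesianProduct (𝟙 ∘ S) (allFin 4) (cartesianProduct (allFin 4) (allFin 4)) ⟩
  sum (map (λ x → sum (map (λ yz → 𝟙 (S (x , yz))) (cartesianProduct (allFin 4) (allFin 4)))) (allFin 4))
    ≡⟨ cong sum (map-cong (λ x → sum-map-cartesianProduct (λ yz → 𝟙 (S (x , yz))) (allFin 4) (allFin 4))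
                          (allFin 4)) ⟩
  (∑ λ x → ∑ λ y → ∑ λ z → 𝟙 (S (x , y , z))) ∎
  where open ≡-Reasoning

card-cong : ∀ {S S′} → S ≗ S′ → card S ≡ card S′
card-cong {S} {S′} S≗S′ = begin
  card S
    ≡⟨ card-∑ S ⟩
  (∑ λ x → ∑ λ y → ∑ λ z → 𝟙 (S (x , y , z)))
    ≡⟨ sum-cong-≗ (λ x → sum-cong-≗ λ y → sum-cong-≗ λ z → cong 𝟙 (S≗S′ (x , y , z))) ⟩
  (∑ λ x → ∑ λ y → ∑ λ z → 𝟙 (S′ (x , y , z)))
    ≡⟨ sym (card-∑ S′) ⟩
  card S′ ∎
  where open ≡-Reasoning

Relabelling : Set
Relabelling = Permutation′ 4 × Permutation′ 4 × Permutation′ 4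

infixr 25 _·_
_·_ : Relabelling → Point → Point
(π₁ , π₂ , π₃) · (x , y , z) = π₁ ⟨$⟩ʳ x , π₂ ⟨$⟩ʳ y , π₃ ⟨$⟩ʳ z

infix 30 _⁻¹
_⁻¹ : Relabelling → Relabelling
(π₁ , π₂ , π₃) ⁻¹ = flip π₁ , flip π₂ , flip π₃

·-inverseʳ : ∀ ρ p → ρ · ρ ⁻¹ · p ≡ p
·-inverseʳ (π₁ , π₂ , π₃) (x , y , z) =
  cong₂ _,_ (inverseʳ π₁) (cong₂ _,_ (inverseʳ π₂) (inverseʳ π₃))

card-relabel : ∀ ρ S → card (S ∘ (ρ ·_)) ≡ card S
card-relabel ρ@(π₁ , π₂ , π₃) S = begin
  card (S ∘ (ρ ·_))
    ≡⟨ card-∑ (S ∘ (ρ ·_)) ⟩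
  (∑ λ x → ∑ λ y → ∑ λ z → 𝟙 (S (π₁ ⟨$⟩ʳ x , π₂ ⟨$⟩ʳ y , π₃ ⟨$⟩ʳ z)))
    ≡⟨ sum-cong-≗ (λ x → sum-cong-≗ λ y → sym (sum-permute (λ z → 𝟙 (S (π₁ ⟨$⟩ʳ x , π₂ ⟨$⟩ʳ y , z))) π₃)) ⟩
  (∑ λ x → ∑ λ y → ∑ λ z → 𝟙 (S (π₁ ⟨$⟩ʳ x , π₂ ⟨$⟩ʳ y , z)))
    ≡⟨ sum-cong-≗ (λ x → sym (sum-permute (λ y → ∑ λ z → 𝟙 (S (π₁ ⟨$⟩ʳ x , y , z))) π₂)) ⟩
  (∑ λ x → ∑ λ y → ∑ λ z → 𝟙 (S (π₁ ⟨$⟩ʳ x , y , z)))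
    ≡⟨ sym (sum-permute (λ x → ∑ λ y → ∑ λ z → 𝟙 (S (x , y , z))) π₁) ⟩
  (∑ λ x → ∑ λ y → ∑ λ z → 𝟙 (S (x , y , z)))
    ≡⟨ sym (card-∑ S) ⟩
  card S ∎
  where open ≡-Reasoning

∣p∣≡n⇒p≡∁⁅i⁆ : ∀ {n} (A : Subset (suc n)) → ∣ A ∣ ≡ n → ∃ λ m → A ≡ ∁ ⁅ m ⁆
∣p∣≡n⇒p≡∁⁅i⁆ {n} (outside ∷ A) ∣A∣≡n =
  zero , cong (outside ∷_) (trans (∣p∣≡n⇒p≡⊤ ∣A∣≡n) (sym (map-replicate not outside n)))
∣p∣≡n⇒p≡∁⁅i⁆ {zero}  (inside ∷ A) ()
∣p∣≡n⇒p≡∁⁅i⁆ {suc n} (inside ∷ A) ∣A∣≡n with ∣p∣≡n⇒p≡∁⁅i⁆ A (suc-injective ∣A∣≡n)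
... | m , A≡∁⁅m⁆ = suc m , cong (inside ∷_) A≡∁⁅m⁆

avoiding : Point → PointSet
avoiding (m₁ , m₂ , m₃) = box (∁ ⁅ m₁ ⁆) (∁ ⁅ m₂ ⁆) (∁ ⁅ m₃ ⁆)

cube-avoiding : (C : Cube) → ∃ λ m → ⟦ C ⟧ ≡ avoiding m
cube-avoiding (cube A B C ∣A∣≡3 ∣B∣≡3 ∣C∣≡3)
  with ∣p∣≡n⇒p≡∁⁅i⁆ A ∣A∣≡3 | ∣p∣≡n⇒p≡∁⁅i⁆ B ∣B∣≡3 | ∣p∣≡n⇒p≡∁⁅i⁆ C ∣C∣≡3
... | m₁ , refl | m₂ , refl | m₃ , refl = (m₁ , m₂ , m₃) , refl

∣∁⁅i⁆∣≡n : ∀ {n} (i : Fin (suc n)) → ∣ ∁ ⁅ i ⁆ ∣ ≡ n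
∣∁⁅i⁆∣≡n {n} i = trans (∣∁p∣≡n∸∣p∣ ⁅ i ⁆) (cong (suc n ∸_) (∣⁅x⁆∣≡1 i))

does-≟-permute : ∀ {n} (π : Permutation′ n) x y → does (π ⟨$⟩ʳ x ≟ π ⟨$⟩ʳ y) ≡ does (x ≟ y)
does-≟-permute π x y = does-⇔ (mk⇔ injective (cong (π ⟨$⟩ʳ_))) (π ⟨$⟩ʳ x ≟ π ⟨$⟩ʳ y) (x ≟ y)
  where
  injective : π ⟨$⟩ʳ x ≡ π ⟨$⟩ʳ y → x ≡ y
  injective πx≡πy = trans (sym (inverseˡ π)) (trans (cong (π ⟨$⟩ˡ_) πx≡πy) (inverseˡ π))

does-∈∁⁅⁆ : ∀ {n} (x m : Fin n) → does (x ∈ₛ? ∁ ⁅ m ⁆) ≡ not (does (x ≟ m))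
does-∈∁⁅⁆ x m = begin
  does (x ∈ₛ? ∁ ⁅ m ⁆)        ≡⟨ does-⇔ (mk⇔ x∈∁p⇒x∉p x∉p⇒x∈∁p) (x ∈ₛ? ∁ ⁅ m ⁆) (¬? (x ∈ₛ? ⁅ m ⁆)) ⟩
  not (does (x ∈ₛ? ⁅ m ⁆))    ≡⟨ cong not (does-⇔ x∈⁅y⁆⇔x≡y (x ∈ₛ? ⁅ m ⁆) (x ≟ m)) ⟩
  not (does (x ≟ m))         ∎
  where open ≡-Reasoning

does-∈∁⁅⁆-permute : ∀ {n} (π : Permutation′ n) x m →
  does (π ⟨$⟩ʳ x ∈ₛ? ∁ ⁅ π ⟨$⟩ʳ m ⁆) ≡ does (x ∈ₛ? ∁ ⁅ m ⁆)
does-∈∁⁅⁆-permute π x m = begin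
  does (π ⟨$⟩ʳ x ∈ₛ? ∁ ⁅ π ⟨$⟩ʳ m ⁆)   ≡⟨ does-∈∁⁅⁆ (π ⟨$⟩ʳ x) (π ⟨$⟩ʳ m) ⟩
  not (does (π ⟨$⟩ʳ x ≟ π ⟨$⟩ʳ m))   ≡⟨ cong not (does-≟-permute π x m) ⟩
  not (does (x ≟ m))                 ≡⟨ does-∈∁⁅⁆ x m ⟨
  does (x ∈ₛ? ∁ ⁅ m ⁆)                ∎
  where open ≡-Reasoning

avoiding-relabel : ∀ ρ m p → avoiding (ρ · m) (ρ · p) ≡ avoiding m p
avoiding-relabel (π₁ , π₂ , π₃) (m₁ , m₂ , m₃) (x , y , z) =
  cong₂ _∧_ (does-∈∁⁅⁆-permute π₁ x m₁)
    (cong₂ _∧_ (does-∈∁⁅⁆-permute π₂ y m₂) (does-∈∁⁅⁆-permute π₃ z m₃))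

≟ₚ-relabel : ∀ ρ p q → (ρ · p ≟ₚ ρ · q) ≡ (p ≟ₚ q)
≟ₚ-relabel (π₁ , π₂ , π₃) (x , y , z) (x′ , y′ , z′) =
  cong₂ _∧_ (does-≟-permute π₁ x x′)
    (cong₂ _∧_ (does-≟-permute π₂ y y′) (does-≟-permute π₃ z z′))

puncture : PointSet → Point → PointSet
puncture K q p = K p ∧ not (p ≟ₚ q)

data CubeOrCubeMinusPoint (S : PointSet) : Set where
  whole     : ∀ m → S ≗ avoiding m → CubeOrCubeMinusPoint S
  punctured : ∀ m q → avoiding m q ≡ true → S ≗ puncture (avoiding m) q → CubeOrCubeMinusPoint S

avoiding-∘relabel : ∀ ρ m → avoiding m ∘ (ρ ·_) ≗ avoiding (ρ ⁻¹ · m)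
avoiding-∘relabel ρ m p = begin
  avoiding m (ρ · p)                 ≡⟨ cong (λ m′ → avoiding m′ (ρ · p)) (·-inverseʳ ρ m) ⟨
  avoiding (ρ · ρ ⁻¹ · m) (ρ · p)    ≡⟨ avoiding-relabel ρ (ρ ⁻¹ · m) p ⟩
  avoiding (ρ ⁻¹ · m) p              ∎
  where open ≡-Reasoning

puncture-∘relabel : ∀ ρ m q → puncture (avoiding m) q ∘ (ρ ·_) ≗ puncture (avoiding (ρ ⁻¹ · m)) (ρ ⁻¹ · q)
puncture-∘relabel ρ m q p = cong₂ (λ b b′ → b ∧ not b′) (avoiding-∘relabel ρ m p)
  (trans (cong (ρ · p ≟ₚ_) (sym (·-inverseʳ ρ q))) (≟ₚ-relabel ρ p (ρ ⁻¹ · q)))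

cubeOrCubeMinusPoint-relabel : ∀ ρ {S S′} → (∀ p → S p ≡ S′ (ρ · p)) →
  CubeOrCubeMinusPoint S′ → CubeOrCubeMinusPoint S
cubeOrCubeMinusPoint-relabel ρ S≡S′∘ρ (whole m S′≗K) =
  whole (ρ ⁻¹ · m) λ p → trans (S≡S′∘ρ p) (trans (S′≗K (ρ · p)) (avoiding-∘relabel ρ m p))
cubeOrCubeMinusPoint-relabel ρ S≡S′∘ρ (punctured m q q∈K S′≗K∖q) =
  punctured (ρ ⁻¹ · m) (ρ ⁻¹ · q)
    (trans (sym (avoiding-∘relabel ρ m (ρ ⁻¹ · q))) (trans (cong (avoiding m) (·-inverseʳ ρ q)) q∈K))
    λ p → trans (S≡S′∘ρ p) (trans (S′≗K∖q (ρ · p)) (puncture-∘relabel ρ m q p))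

isCube-avoiding : ∀ {S} m → S ≗ avoiding m → IsCube S
isCube-avoiding (m₁ , m₂ , m₃) S≗K =
  ∁ ⁅ m₁ ⁆ , ∁ ⁅ m₂ ⁆ , ∁ ⁅ m₃ ⁆ , ∣∁⁅i⁆∣≡n m₁ , ∣∁⁅i⁆∣≡n m₂ , ∣∁⁅i⁆∣≡n m₃ , S≗K

cubeOrCubeMinusPoint-sound : ∀ {S} → CubeOrCubeMinusPoint S → IsCube S ⊎ IsCubeMinusPoint S
cubeOrCubeMinusPoint-sound (whole m S≗K) = inj₁ (isCube-avoiding m S≗K)
cubeOrCubeMinusPoint-sound (punctured m q q∈K S≗K∖q) =
  inj₂ (avoiding m , isCube-avoiding m (λ _ → refl) , q , q∈K , S≗K∖q)

Column : Set
Column = Vec (Fin 4) 4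

Configuration : Set
Configuration = Column × Column × Column

cubeAt : Configuration → Fin 4 → PointSet
cubeAt (a , b , c) i = avoiding (lookup a i , lookup b i , lookup c i)

twoIntersection : Configuration → PointSet
twoIntersection κ = twoInt4 (cubeAt κ 0F) (cubeAt κ 1F) (cubeAt κ 2F) (cubeAt κ 3F)

relabelColumn : Permutation′ 4 → Column → Column
relabelColumn π = Vec.map (π ⟨$⟩ʳ_)

infixr 25 _⊙_
_⊙_ : Relabelling → Configuration → Configuration
(π₁ , π₂ , π₃) ⊙ (a , b , c) = relabelColumn π₁ a , relabelColumn π₂ b , relabelColumn π₃ c

cubeAt-relabel : ∀ ρ κ i p → cubeAt (ρ ⊙ κ) i (ρ · p) ≡ cubeAt κ i p
cubeAt-relabel ρ@(π₁ , π₂ , π₃) (a , b , c) i p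
  rewrite lookup-map i (π₁ ⟨$⟩ʳ_) a | lookup-map i (π₂ ⟨$⟩ʳ_) b | lookup-map i (π₃ ⟨$⟩ʳ_) c =
  avoiding-relabel ρ (lookup a i , lookup b i , lookup c i) p

twoIntersection-relabel : ∀ ρ κ p → twoIntersection κ p ≡ twoIntersection (ρ ⊙ κ) (ρ · p)
twoIntersection-relabel ρ κ p
  rewrite cubeAt-relabel ρ κ 0F p | cubeAt-relabel ρ κ 1F p
        | cubeAt-relabel ρ κ 2F p | cubeAt-relabel ρ κ 3F p = refl

permutations : ∀ n → List (Permutation′ n)
permutations zero    = id ∷ []
permutations (suc n) =
  cartesianProductWith (λ i σ → transpose 0F i ∘ₚ lift₀ σ) (allFin (suc n)) (permutations n)

-- Up to relabelling a column only records which cubes share a coordinate, i.e. a set partition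
-- of the four cubes; these are its restricted growth strings.
normalColumns : List Column
normalColumns =
  (0F ∷ 0F ∷ 0F ∷ 0F ∷ []) ∷ (0F ∷ 0F ∷ 0F ∷ 1F ∷ []) ∷ (0F ∷ 0F ∷ 1F ∷ 0F ∷ []) ∷
  (0F ∷ 0F ∷ 1F ∷ 1F ∷ []) ∷ (0F ∷ 0F ∷ 1F ∷ 2F ∷ []) ∷ (0F ∷ 1F ∷ 0F ∷ 0F ∷ []) ∷
  (0F ∷ 1F ∷ 0F ∷ 1F ∷ []) ∷ (0F ∷ 1F ∷ 0F ∷ 2F ∷ []) ∷ (0F ∷ 1F ∷ 1F ∷ 0F ∷ []) ∷
  (0F ∷ 1F ∷ 1F ∷ 1F ∷ []) ∷ (0F ∷ 1F ∷ 1F ∷ 2F ∷ []) ∷ (0F ∷ 1F ∷ 2F ∷ 0F ∷ []) ∷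
  (0F ∷ 1F ∷ 2F ∷ 1F ∷ []) ∷ (0F ∷ 1F ∷ 2F ∷ 2F ∷ []) ∷ (0F ∷ 1F ∷ 2F ∷ 3F ∷ []) ∷ []

column-normalisable : (a : Column) → ∃ λ π → relabelColumn π a ∈ normalColumns
column-normalisable (a₁ ∷ a₂ ∷ a₃ ∷ a₄ ∷ []) = satisfied (from-yes everyColumnNormalisable? a₁ a₂ a₃ a₄)
  where
  normalisable? : (a : Column) → Dec (Any (λ π → relabelColumn π a ∈ normalColumns) (permutations 4))
  normalisable? a = any? (λ π → relabelColumn π a ∈? normalColumns) (permutations 4)
  everyColumnNormalisable? : Dec (∀ a₁ a₂ a₃ a₄ →
    Any (λ π → relabelColumn π (a₁ ∷ a₂ ∷ a₃ ∷ a₄ ∷ []) ∈ normalColumns) (permutations 4))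
  everyColumnNormalisable? =
    Fin.all? λ a₁ → Fin.all? λ a₂ → Fin.all? λ a₃ → Fin.all? λ a₄ → normalisable? (a₁ ∷ a₂ ∷ a₃ ∷ a₄ ∷ [])

Normal : Configuration → Set
Normal (a , b , c) = a ∈ normalColumns × b ∈ normalColumns × c ∈ normalColumns

normalise : ∀ κ → ∃ λ ρ → Normal (ρ ⊙ κ)
normalise (a , b , c) with column-normalisable a | column-normalisable b | column-normalisable c
... | π₁ , a′∈ | π₂ , b′∈ | π₃ , c′∈ = (π₁ , π₂ , π₃) , a′∈ , b′∈ , c′∈

_≗?_ : (S S′ : PointSet) → Dec (S ≗ S′)
S ≗? S′ = map′ (λ h (x , y , z) → h x y z) (λ h x y z → h (x , y , z))
  (Fin.all? λ x → Fin.all? λ y → Fin.all? λ z → S (x , y , z) Bool.≟ S′ (x , y , z))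

pointWith? : (S : PointSet) → Dec (∃ λ p → S p ≡ true)
pointWith? S = map′ (λ (x , y , z , h) → (x , y , z) , h) (λ ((x , y , z) , h) → x , y , z , h)
  (Fin.any? λ x → Fin.any? λ y → Fin.any? λ z → S (x , y , z) Bool.≟ true)

-- The candidate m: a cube avoiding m, even with a point removed, has empty layers exactly at the
-- coordinates of m.
emptyLayer : (Fin 4 → Fin 4 → Fin 4 → Bool) → Maybe (Fin 4)
emptyLayer L with Fin.any? (λ i → Fin.all? λ j → Fin.all? λ k → L i j k Bool.≟ false)
... | yes (i , _) = just i
... | no _        = nothing

avoidedPoint : PointSet → Maybe Point
avoidedPoint S = do
  x ← emptyLayer λ x y z → S (x , y , z)
  y ← emptyLayer λ y x z → S (x , y , z)
  z ← emptyLayer λ z x y → S (x , y , z)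
  just (x , y , z)

∧-trueˡ : ∀ {a b} → a ∧ b ≡ true → a ≡ true
∧-trueˡ {true} _ = refl

recogniseAvoiding : ∀ m S → Maybe (CubeOrCubeMinusPoint S)
recogniseAvoiding m S with S ≗? avoiding m | pointWith? (λ p → avoiding m p ∧ not (S p))
... | yes S≗K | _ = just (whole m S≗K)
... | no _    | no _ = nothing
... | no _    | yes (q , q∈K∖S) with S ≗? puncture (avoiding m) q
...   | yes S≗K∖q = just (punctured m q (∧-trueˡ q∈K∖S) S≗K∖q)
...   | no _ = nothing

recognise : (S : PointSet) → Maybe (CubeOrCubeMinusPoint S)
recognise S = avoidedPoint S >>= λ m → recogniseAvoiding m S

classify : (S : PointSet) → Maybe (card S ≤ 29 → CubeOrCubeMinusPoint S)
classify S with 29 <? card S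
... | yes 29<∣S∣ = just λ ∣S∣≤29 → contradiction ∣S∣≤29 (<⇒≱ 29<∣S∣)
... | no _       = Maybe.map const (recognise S)

normalConfigurations-classified :
  All (λ a → All (λ b → All (λ c → T (is-just (classify (twoIntersection (a , b , c)))))
    normalColumns) normalColumns) normalColumns
normalConfigurations-classified = from-yes (all? λ a → all? λ b → all? λ c →
  T? (is-just (classify (twoIntersection (a , b , c)))))
  where
  all? : {P : Column → Set} → (∀ a → Dec (P a)) → Dec (All P normalColumns)
  all? P? = All.all? P? normalColumns

normal-twoIntersection-shape : ∀ κ → Normal κ →
  card (twoIntersection κ) ≤ 29 → CubeOrCubeMinusPoint (twoIntersection κ)
normal-twoIntersection-shape κ (a∈ , b∈ , c∈) = to-witness-T (classify (twoIntersection κ))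
  (All.lookup (All.lookup (All.lookup normalConfigurations-classified a∈) b∈) c∈)

twoIntersection-shape : ∀ κ → card (twoIntersection κ) ≤ 29 → CubeOrCubeMinusPoint (twoIntersection κ)
twoIntersection-shape κ ∣S∣≤29 with normalise κ
... | ρ , ρκ-normal = cubeOrCubeMinusPoint-relabel ρ (twoIntersection-relabel ρ κ)
  (normal-twoIntersection-shape (ρ ⊙ κ) ρκ-normal (subst (_≤ 29) ∣S∣≡∣S′∣ ∣S∣≤29))
  where
  ∣S∣≡∣S′∣ : card (twoIntersection κ) ≡ card (twoIntersection (ρ ⊙ κ))
  ∣S∣≡∣S′∣ = trans (card-cong (twoIntersection-relabel ρ κ)) (card-relabel ρ (twoIntersection (ρ ⊙ κ)))

configuration : Point → Point → Point → Point → Configuration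
configuration (x₁ , y₁ , z₁) (x₂ , y₂ , z₂) (x₃ , y₃ , z₃) (x₄ , y₄ , z₄) =
  (x₁ ∷ x₂ ∷ x₃ ∷ x₄ ∷ []) , (y₁ ∷ y₂ ∷ y₃ ∷ y₄ ∷ []) , (z₁ ∷ z₂ ∷ z₃ ∷ z₄ ∷ [])

mainTheorem8 : (C₁ C₂ C₃ C₄ : Cube) →
    card (twoInt4 ⟦ C₁ ⟧ ⟦ C₂ ⟧ ⟦ C₃ ⟧ ⟦ C₄ ⟧) ≤ 29 →
    IsCube (twoInt4 ⟦ C₁ ⟧ ⟦ C₂ ⟧ ⟦ C₃ ⟧ ⟦ C₄ ⟧) ⊎ IsCubeMinusPoint (twoInt4 ⟦ C₁ ⟧ ⟦ C₂ ⟧ ⟦ C₃ ⟧ ⟦ C₄ ⟧)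
mainTheorem8 C₁ C₂ C₃ C₄ with cube-avoiding C₁ | cube-avoiding C₂ | cube-avoiding C₃ | cube-avoiding C₄
... | m₁ , ⟦C₁⟧≡ | m₂ , ⟦C₂⟧≡ | m₃ , ⟦C₃⟧≡ | m₄ , ⟦C₄⟧≡ = twoIntersectionOfCubes ⟦C₁⟧≡ ⟦C₂⟧≡ ⟦C₃⟧≡ ⟦C₄⟧≡
  where
  twoIntersectionOfCubes : ∀ {S₁ S₂ S₃ S₄} →
    S₁ ≡ avoiding m₁ → S₂ ≡ avoiding m₂ → S₃ ≡ avoiding m₃ → S₄ ≡ avoiding m₄ →
    card (twoInt4 S₁ S₂ S₃ S₄) ≤ 29 → IsCube (twoInt4 S₁ S₂ S₃ S₄) ⊎ IsCubeMinusPoint (twoInt4 S₁ S₂ S₃ S₄)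
  twoIntersectionOfCubes refl refl refl refl =
    cubeOrCubeMinusPoint-sound ∘ twoIntersection-shape (configuration m₁ m₂ m₃ m₄)
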